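{- Let $(X,\theta)$ be a commutation alphabet and $R\subseteq X\times\mathcal{S}(X,\theta)$ such that the alphabetic rewriting system $(\mathcal{S}(X,\theta),\Rightarrow_R)$ is convergent. If $w,w'\in\mathsf{Irr}(\mathcal{S}(X,\theta),\Rightarrow_R)$, then $ww'\in\mathsf{Irr}(\mathcal{S}(X,\theta),\Rightarrow_R)$. Consequently $\mathsf{Irr}(\mathcal{S}(X,\theta),\Rightarrow_R)$ is a sub-semigroup of $\mathcal{S}(X,\theta)$.
   Context: A commutation alphabet is a pair $(X,\theta)$ with $\theta\subseteq X\times X$ symmetric and irreflexive. $\mathcal{S}(X,\theta)=X^+/\equiv_\theta$ and $\mathcal{M}(X,\theta)=X^*/\equiv_\theta=\mathcal{S}(X,\theta)\cup\{\epsilon\}$, where $\equiv_\theta$ is the congruence generated by $(xy,yx)$, $(x,y)\in\theta$; $X$ is identified with its image in $\mathcal{S}(X,\theta)$. $w\Rightarrow_R w'$ iff $w=uav$, $w'=ubv$ for some $u,v\in\mathcal{M}(X,\theta)$, $(a,b)\in R$. Convergent means terminating (no infinite $\Rightarrow_R$-chain) and confluent. $\mathsf{Irr}(\mathcal{S}(X,\theta),\Rightarrow_R)$ is the set of $w$ admitting no $w'$ with $w\Rightarrow_R w'$. -}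

module Defs where

open import Data.List using (List; []; _∷_; _++_)
open import Data.Nat using (ℕ; suc)
open import Data.Product using (Σ; ∃; ∃-syntax; _×_; _,_)
open import Data.Empty using (⊥)
open import Data.Unit using (⊤)
open import Relation.Nullary using (¬_)
open import Relation.Binary.Construct.Closure.Equivalence using (EqClosure)
open import Relation.Binary.Construct.Closure.ReflexiveTransitive using (Star)

record CommutationAlphabet (X : Set) (θ : X → X → Set) : Set where
  field
    θ-sym   : ∀ {x y} → θ x y → θ y x
    θ-irrefl : ∀ {x} → ¬ θ x x

-- Words in X* (elements of the free monoid).  Traces are represented by
-- words up to the congruence ≡θ below; elements of 𝒮(X,θ) = nonempty words.
NonEmpty : {X : Set} → List X → Set
NonEmpty []      = ⊥
NonEmpty (_ ∷ _) = ⊤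

data Swap {X : Set} (θ : X → X → Set) : List X → List X → Set where
  swap : ∀ (u v : List X) {x y : X} → θ x y →
         Swap θ (u ++ x ∷ y ∷ v) (u ++ y ∷ x ∷ v)

-- ≡θ : the congruence on X* generated by (xy, yx), (x,y) ∈ θ
-- (equivalence closure of elementary commutations, which is already a congruence)
_≡[_]_ : {X : Set} → List X → (X → X → Set) → List X → Set
w ≡[ θ ] w' = EqClosure (Swap θ) w w'

-- R ⊆ X × 𝒮(X,θ): a relation between letters and nonempty words
-- (the right-hand side is read as its trace class).
-- One rewriting step  w ⇒_R w'  iff  w = u a v, w' = u b v in 𝓜(X,θ), (a,b) ∈ R.
Step : {X : Set} (θ : X → X → Set) (R : X → List X → Set) → List X → List X → Set
Step {X} θ R w w' =
  ∃[ u ] ∃[ v ] ∃[ a ] ∃[ b ]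
    (R a b × (w ≡[ θ ] (u ++ a ∷ v)) × (w' ≡[ θ ] (u ++ b ++ v)))

Steps : {X : Set} (θ : X → X → Set) (R : X → List X → Set) → List X → List X → Set
Steps θ R = Star (Step θ R)

Terminating : {X : Set} (θ : X → X → Set) (R : X → List X → Set) → Set
Terminating {X} θ R = ¬ (Σ (ℕ → List X) λ f → ∀ n → Step θ R (f n) (f (suc n)))

-- confluent (joinability taken up to ≡θ, i.e. in the trace monoid)
Confluent : {X : Set} (θ : X → X → Set) (R : X → List X → Set) → Set
Confluent {X} θ R = ∀ (w w₁ w₂ : List X) → Steps θ R w w₁ → Steps θ R w w₂ →
  ∃[ z₁ ] ∃[ z₂ ] (Steps θ R w₁ z₁ × Steps θ R w₂ z₂ × (z₁ ≡[ θ ] z₂))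

Convergent : {X : Set} (θ : X → X → Set) (R : X → List X → Set) → Set
Convergent θ R = Terminating θ R × Confluent θ R

Irr : {X : Set} (θ : X → X → Set) (R : X → List X → Set) → List X → Set
Irr {X} θ R w = NonEmpty w × ¬ (∃[ w' ] Step θ R w w')

module Submission where

-- The rewriting system ⇒_R is alphabetic: every left-hand side is a single
-- letter.  Hence a word is reducible exactly when some letter occurring in it
-- is the left-hand side of a rule (a "redex").  Commutations only permute
-- letters, so letter occurrence is a property of the trace class:
--
-- A redex of ww' is a redex of w or of w' (redex-++), so irreducibility of
-- w and w' forbids any step from ww'; ww' is nonempty because w is.

open import Defs
open import Data.List using (List; _∷_; _++_)
open import Data.List.Membership.Propositional using (_∈_)
open import Data.List.Membership.Propositional.Properties
  using (∈-++⁻; ∈-∃++; ∈-insert)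
open import Data.List.Relation.Binary.Permutation.Propositional
  using (_↭_; ↭-isEquivalence; ↭-sym; ↭-swap; ↭-refl)
open import Data.List.Relation.Binary.Permutation.Propositional.Properties
  using (∈-resp-↭; ++⁺ˡ)
open import Data.Product using (∃-syntax; _×_; _,_; proj₁)
open import Data.Sum using (_⊎_; inj₁; inj₂; map)
open import Relation.Nullary using (¬_)
open import Relation.Binary.PropositionalEquality using (refl)
open import Relation.Binary.Construct.Closure.Equivalence using (fold)
open import Relation.Binary.Construct.Closure.ReflexiveTransitive using (ε)

module _ {X : Set} (θ : X → X → Set) where

  swap⇒↭ : ∀ {w w' : List X} → Swap θ w w' → w ↭ w'
  swap⇒↭ (swap u v {x} {y} _) = ++⁺ˡ u (↭-swap x y ↭-refl)

  ≡θ⇒↭ : ∀ {w w' : List X} → w ≡[ θ ] w' → w ↭ w'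
  ≡θ⇒↭ = fold ↭-isEquivalence swap⇒↭

  ∈-resp-≡θ : ∀ {a : X} {w w' : List X} → w ≡[ θ ] w' → a ∈ w' → a ∈ w
  ∈-resp-≡θ e = ∈-resp-↭ (↭-sym (≡θ⇒↭ e))

  module _ (R : X → List X → Set) where

    Redex : List X → Set
    Redex w = ∃[ a ] ∃[ b ] (R a b × a ∈ w)

    stepRedex : ∀ {w w' : List X} → Step θ R w w' → Redex w
    stepRedex (u , v , a , b , r , e , _) = a , b , r , ∈-resp-≡θ e (∈-insert u)

    redexStep : ∀ {w : List X} → Redex w → ∃[ w' ] Step θ R w w'
    redexStep (a , b , r , a∈w) with u , v , refl ← ∈-∃++ a∈w =
      u ++ b ++ v , u , v , a , b , r , ε , ε

    redex-++ : ∀ (w w' : List X) → Redex (w ++ w') → Redex w ⊎ Redex w'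
    redex-++ w w' (a , b , r , a∈ww') =
      map (λ a∈w → a , b , r , a∈w) (λ a∈w' → a , b , r , a∈w') (∈-++⁻ w a∈ww')

    irr⇒noRedex : ∀ {w : List X} → Irr θ R w → ¬ Redex w
    irr⇒noRedex (_ , irreducible) redex = irreducible (redexStep redex)

nonEmpty-++ : ∀ {X : Set} (w w' : List X) → NonEmpty w → NonEmpty (w ++ w')
nonEmpty-++ (_ ∷ _) _ _ = _

mainTheorem6 : {X : Set} (θ : X → X → Set) → CommutationAlphabet X θ →
    (R : X → List X → Set) → (∀ {a b} → R a b → NonEmpty b) →
    Convergent θ R →
    ∀ (w w' : List X) → Irr θ R w → Irr θ R w' → Irr θ R (w ++ w')
mainTheorem6 θ _ R _ _ w w' irr irr' =
  nonEmpty-++ w w' (proj₁ irr) , noStep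
  where
    noStep : ¬ (∃[ z ] Step θ R (w ++ w') z)
    noStep (_ , step) with redex-++ θ R w w' (stepRedex θ R step)
    ... | inj₁ redex  = irr⇒noRedex θ R irr redex
    ... | inj₂ redex' = irr⇒noRedex θ R irr' redex'
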